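{- Let $c$ be a Coxeter element of $D_n$ with cycle type $(k_1\,\dots\,k_{2n-2})(1,-1)$, $k_i\in\{\pm2,\dots,\pm n\}$. Then each type D folded chord diagram corresponds to exactly two minimal factorizations of $c$; that is, for every minimal factorization $(r_1,\dots,r_n)$ of $c$ there are exactly two minimal factorizations of $c$ (including it) having the same type D folded chord diagram.
   Context: $D_n$ acts on $\pm[n]$ by signed permutations with an even number of sign changes; its reflections are, for $a\neq b$ in $[n]$, the reflection swapping $a\leftrightarrow b$, $-a\leftrightarrow-b$ (root $e_a-e_b$) and the reflection swapping $a\leftrightarrow-b$, $-a\leftrightarrow b$ (root $e_a+e_b$). A minimal factorization of $c$ is $(r_1,\dots,r_n)$ of reflections with $c=r_1\cdots r_n$. The type D folded chord diagram of $(r_1,\dots,r_n)$ has $|k_1|,\dots,|k_{n-1}|$ placed clockwise on an outer circle and $1$ on an inner circle, and for each $k$ a chord labeled $k$ between $a$ and $b$ whenever $r_k$ is one of the two reflections with root $e_a\pm e_b$; i.e. it is the edge-labeled multigraph on $[n]$ recording, for each $r_k$, the unordered pair $\{a,b\}$ with $|r_k(a)|=b$, forgetting whether the root is $e_a-e_b$ or $e_a+e_b$. -}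

module Defs where

open import Data.Nat using (ℕ; zero; suc; _+_)
open import Data.Nat.Divisibility using (_∣_)
open import Data.Fin using (Fin; zero; suc; _<_)
open import Data.Fin.Properties using () renaming (_≟_ to _≟F_)
open import Data.List using (List; []; _∷_; allFin)
open import Data.Vec using (Vec; map)
open import Data.Bool using (Bool; true; false)
open import Data.Product using (_×_; _,_)
open import Relation.Nullary using (yes; no; ¬_)
open import Relation.Binary.PropositionalEquality using (_≡_)
open import Function.Definitions using (Injective)

-- Signed elements of ±[n]; the element i of [n] is represented by Fin n
-- (index zero is the element 1).  pos a = +a, neg a = -a.
data SFin (n : ℕ) : Set where
  pos : Fin n → SFin n
  neg : Fin n → SFin n

minus : ∀ {n} → SFin n → SFin n
minus (pos a) = neg a
minus (neg a) = pos a

absS : ∀ {n} → SFin n → Fin n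
absS (pos a) = a
absS (neg a) = a

isNegB : ∀ {n} → SFin n → Bool
isNegB (pos _) = false
isNegB (neg _) = true

signChanges : ∀ {n} → (SFin n → SFin n) → ℕ
signChanges {n} w = go (allFin n)
  where
  go : List (Fin n) → ℕ
  go [] = 0
  go (a ∷ as) with isNegB (w (pos a))
  ... | true  = suc (go as)
  ... | false = go as

-- w is an element of D_n: a signed permutation of ±[n] (a bijection
-- commuting with negation; injectivity suffices on a finite set)
-- with an even number of sign changes.
record InDn (n : ℕ) (w : SFin n → SFin n) : Set where
  field
    injective  : Injective _≡_ _≡_ w
    odd-fun    : ∀ x → w (minus x) ≡ minus (w x)
    even-signs : 2 ∣ signChanges w

-- Reflections of D_n, in canonical form: for a < b in [n],
--   reflection a b a<b false : root e_a - e_b  (a ↔ b, -a ↔ -b)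
--   reflection a b a<b true  : root e_a + e_b  (a ↔ -b, -a ↔ b)
-- Every reflection of D_n has exactly one such representation.
data Refl (n : ℕ) : Set where
  reflection : (a b : Fin n) → a < b → (plusRoot : Bool) → Refl n

actR : ∀ {n} → Refl n → SFin n → SFin n
actR (reflection a b _ false) (pos x) with x ≟F a | x ≟F b
... | yes _ | _     = pos b
... | no _  | yes _ = pos a
... | no _  | no _  = pos x
actR (reflection a b _ false) (neg x) with x ≟F a | x ≟F b
... | yes _ | _     = neg b
... | no _  | yes _ = neg a
... | no _  | no _  = neg x
actR (reflection a b _ true) (pos x) with x ≟F a | x ≟F b
... | yes _ | _     = neg b
... | no _  | yes _ = neg a
... | no _  | no _  = pos x
actR (reflection a b _ true) (neg x) with x ≟F a | x ≟F b
... | yes _ | _     = pos b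
... | no _  | yes _ = pos a
... | no _  | no _  = neg x

-- product r₁ r₂ ⋯ r_k as a map on ±[n] (composition of functions:
-- (r₁ ⋯ r_k)(x) = r₁(r₂(⋯ r_k(x))))
prodR : ∀ {n k} → Vec (Refl n) k → SFin n → SFin n
prodR Vec.[] x = x
prodR (r Vec.∷ rs) x = actR r (prodR rs x)

MinFact : ∀ n → (SFin n → SFin n) → Vec (Refl n) n → Set
MinFact n c rs = ∀ x → prodR rs x ≡ c x

-- chord of a reflection: the unordered pair {a,b} (stored as a < b),
-- forgetting whether the root is e_a - e_b or e_a + e_b
chord : ∀ {n} → Refl n → Fin n × Fin n
chord (reflection a b _ _) = a , b

-- type D folded chord diagram of (r₁,…,r_k): the chord of r_k labelled k
diagram : ∀ {n k} → Vec (Refl n) k → Vec (Fin n × Fin n) k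
diagram = map chord

-- cyclic successor on Fin (suc j)
next : ∀ {j} → Fin (suc j) → Fin (suc j)
next {zero} zero = zero
next {suc j} zero = suc zero
next {suc j} (suc i) with next i
... | zero  = zero
... | suc r = suc (suc r)

-- c has cycle type (k₁ … k_{2n-2})(1,-1) with all k_i ∈ {±2,…,±n},
-- for n = p + 2 (so 2n-2 = suc p + suc p; the element 1 is Fin index zero):
-- c(1) = -1, c(-1) = 1, and c maps k_i ↦ k_{i+1} (indices mod 2n-2),
-- the k_i being pairwise distinct with |k_i| ≠ 1.
record HasCycleType (p : ℕ) (c : SFin (suc (suc p)) → SFin (suc (suc p)))
                    (k : Fin (suc p + suc p) → SFin (suc (suc p))) : Set where
  field
    c-one      : c (pos zero) ≡ neg zero
    c-minusone : c (neg zero) ≡ pos zero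
    k-distinct : Injective _≡_ _≡_ k
    k-range    : ∀ i → ¬ (absS (k i) ≡ zero)
    c-cycle    : ∀ i → c (k i) ≡ k (next i)

{-# OPTIONS --safe #-}
-- Factorizations with the diagram of rs differ from rs only in whether each root is e_a - e_b or
-- e_a + e_b, i.e. by toggling a set d of positions. Toggling d multiplies the product by the sign
-- changes on the 𝔽₂-boundary of d in the graph whose i-th edge is the chord of the conjugated
-- reflection (r₁ ⋯ rᵢ₋₁) rᵢ (r₁ ⋯ rᵢ₋₁)⁻¹, so these factorizations correspond to the cycles of that
-- graph. It has n vertices and n edges and is connected: c moves each |kᵢ| to |kᵢ₊₁| inside a
-- component, the kᵢ exhaust ±2, …, ±n, and since c(1) = -1 some edge touches 1. Hence its cycle space
-- has exactly two elements; the nonzero one comes from conjugating rs by the sign change at 1, which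
-- toggles exactly the reflections moving 1 and commutes with c.
module Submission where

open import Defs
open import Algebra.Bundles using (CommutativeMonoid; CommutativeRing)
import Algebra.Properties.CommutativeMonoid.Sum as CommutativeMonoidSum
import Algebra.Properties.Semiring.Sum as SemiringSum
open import Data.Bool using (Bool; true; false; _∧_; _xor_; if_then_else_)
open import Data.Bool.Properties
  using (∧-zeroʳ; ∧-identityʳ; ∧-distribʳ-xor; xor-same; xor-comm; xor-assoc; xor-identityʳ; xor-∧-commutativeRing)
open import Data.Bool.Solver using (module xor-∧-Solver)
open import Algebra.Properties.Group (CommutativeRing.+-group xor-∧-commutativeRing)
  using () renaming (∙-cancelˡ to xor-cancelˡ)
open import Data.Fin using (Fin; zero; suc; punchIn; punchOut; inject₁; _↑ˡ_; _↑ʳ_; splitAt)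
open import Data.Fin.Properties
  using (_≟_; punchInᵢ≢i; punchOut-injective; <⇒≢; <-irrelevant; any?; injective⇒≤; splitAt-↑ˡ; splitAt-↑ʳ)
open import Data.Fin.Induction using (<-weakInduction)
open import Data.Fin.Subset using (Subset; ⊥; _∩_; ∣_∣)
open import Data.Fin.Subset.Properties using (∩-zeroˡ; ∩-zeroʳ)
open import Data.Nat using (ℕ; zero; suc; _+_)
open import Data.Nat.Properties
  using (+-0-commutativeMonoid; +-suc; +-comm; +-identityʳ; +-cancelˡ-≡; suc-injective; 1+n≰n)
open import Data.Product using (Σ; _×_; _,_; ∃; proj₁; proj₂)
open import Data.Sum as Sum using (_⊎_; inj₁; inj₂)
open import Data.Vec using (Vec; []; _∷_; map; zipWith)
open import Data.Vec.Properties using (∷-injectiveˡ; ∷-injectiveʳ)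
open import Data.Vec.Relation.Unary.All as All using (All; []; _∷_)
open import Data.Vec.Relation.Unary.All.Properties using (map⁺; map⁻)
open import Function using (_∘_; case_of_)
open import Function.Definitions using (Injective)
open import Relation.Nullary using (¬_; Dec; yes; no; does; contradiction)
open import Relation.Nullary.Decidable using (dec-true; dec-false; dec-no)
open import Relation.Binary.PropositionalEquality
  using (_≡_; _≢_; refl; sym; trans; cong; cong₂; subst; module ≡-Reasoning)

private variable
  n m : ℕ

infix 4 _==_
_==_ : Fin n → Fin n → Bool
x == y = does (x ≟ y)

==-refl : (x : Fin n) → (x == x) ≡ true
==-refl x = dec-true (x ≟ x) refl

≢⇒==-false : {x y : Fin n} → x ≢ y → (x == y) ≡ false
≢⇒==-false {x = x} {y} = dec-false (x ≟ y)

module _ {a ℓ} (M : CommutativeMonoid a ℓ) where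
  open CommutativeMonoid M using (Carrier; _≈_; _∙_; ε; ∙-congˡ; identityʳ; setoid)
  open CommutativeMonoidSum M using (sum; sum-remove; sum-cong-≋; sum-replicate-zero)
  open import Relation.Binary.Reasoning.Setoid setoid

  sum-supported : ∀ {n} (t : Fin n → Carrier) i → (∀ j → j ≢ i → t j ≈ ε) → sum t ≈ t i
  sum-supported {suc n} t i t≈ε = begin
    sum t                               ≈⟨ sum-remove {i = i} t ⟩
    t i ∙ sum (λ j → t (punchIn i j))   ≈⟨ ∙-congˡ (sum-cong-≋ (λ j → t≈ε _ (punchInᵢ≢i i j))) ⟩
    t i ∙ sum {n} (λ _ → ε)             ≈⟨ ∙-congˡ (sum-replicate-zero n) ⟩
    t i ∙ ε                             ≈⟨ identityʳ (t i) ⟩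
    t i                                 ∎

module Parity = SemiringSum (CommutativeRing.semiring xor-∧-commutativeRing)

parity : (Fin n → Bool) → Bool
parity = Parity.sum

parity-∧-== : (S : Fin n → Bool) (u : Fin n) → parity (λ x → S x ∧ (x == u)) ≡ S u
parity-∧-== S u =
  trans (sum-supported (CommutativeRing.+-commutativeMonoid xor-∧-commutativeRing) _ u
           (λ x x≢u → trans (cong (S x ∧_) (≢⇒==-false x≢u)) (∧-zeroʳ (S x))))
        (trans (cong (S u ∧_) (==-refl u)) (∧-identityʳ (S u)))

Edge : ℕ → Set
Edge n = Fin n × Fin n

endpoint : Edge n → Fin n → Bool
endpoint (u , v) x = (x == u) xor (x == v)

mapEdge : (Fin n → Fin n) → Edge n → Edge n
mapEdge f e = f (proj₁ e) , f (proj₂ e)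

EdgeInvariant : {A : Set} → (Fin n → A) → Edge n → Set
EdgeInvariant f e = f (proj₁ e) ≡ f (proj₂ e)

Untouched : Fin n → Edge n → Set
Untouched x e = endpoint e x ≡ false

crossing : (Fin n → Bool) → Subset m → Vec (Edge n) m → Bool
crossing S [] [] = false
crossing S (b ∷ d) ((u , v) ∷ L) = (b ∧ (S u xor S v)) xor crossing S d L

boundary : Subset m → Vec (Edge n) m → Fin n → Bool
boundary d L x = crossing (x ==_) d L

IsCycle : Subset m → Vec (Edge n) m → Set
IsCycle d L = ∀ x → boundary d L x ≡ false

crossing-⊥ : (S : Fin n → Bool) (L : Vec (Edge n) m) → crossing S ⊥ L ≡ false
crossing-⊥ S [] = refl
crossing-⊥ S (e ∷ L) = crossing-⊥ S L

crossing-invariant : {S : Fin n → Bool} (d : Subset m) (L : Vec (Edge n) m) →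
                     All (EdgeInvariant S) L → crossing S d L ≡ false
crossing-invariant [] [] [] = refl
crossing-invariant {S = S} (b ∷ d) ((u , v) ∷ L) (Su≡Sv ∷ inv)
  rewrite Su≡Sv | xor-same (S v) | ∧-zeroʳ b = crossing-invariant d L inv

parity-∧-boundary : (S : Fin n → Bool) (d : Subset m) (L : Vec (Edge n) m) →
                    parity (λ x → S x ∧ boundary d L x) ≡ crossing S d L
parity-∧-boundary {n} S [] [] =
  trans (Parity.sum-cong-≗ (∧-zeroʳ ∘ S)) (Parity.sum-replicate-zero n)
parity-∧-boundary S (b ∷ d) ((u , v) ∷ L) = begin
  parity (λ x → S x ∧ ((b ∧ ((x == u) xor (x == v))) xor B x))
    ≡⟨ Parity.sum-cong-≗ (λ x → distribute (S x) b (x == u) (x == v) (B x)) ⟩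
  parity (λ x → (b ∧ (Su x xor Sv x)) xor (S x ∧ B x))
    ≡⟨ Parity.∑-distrib-+ (λ x → b ∧ (Su x xor Sv x)) (λ x → S x ∧ B x) ⟩
  parity (λ x → b ∧ (Su x xor Sv x)) xor parity (λ x → S x ∧ B x)
    ≡⟨ cong₂ _xor_ (sym (Parity.*-distribˡ-sum b (λ x → Su x xor Sv x))) (parity-∧-boundary S d L) ⟩
  (b ∧ parity (λ x → Su x xor Sv x)) xor crossing S d L
    ≡⟨ cong (λ s → (b ∧ s) xor crossing S d L) (Parity.∑-distrib-+ Su Sv) ⟩
  (b ∧ (parity Su xor parity Sv)) xor crossing S d L
    ≡⟨ cong (λ s → (b ∧ s) xor crossing S d L) (cong₂ _xor_ (parity-∧-== S u) (parity-∧-== S v)) ⟩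
  (b ∧ (S u xor S v)) xor crossing S d L
    ∎
  where
  open ≡-Reasoning
  B : Fin _ → Bool
  B = boundary d L
  Su Sv : Fin _ → Bool
  Su x = S x ∧ (x == u)
  Sv x = S x ∧ (x == v)
  distribute : ∀ s b p q r → s ∧ ((b ∧ (p xor q)) xor r) ≡ (b ∧ ((s ∧ p) xor (s ∧ q))) xor (s ∧ r)
  distribute = solve 5 (λ s b p q r → s :* ((b :* (p :+ q)) :+ r)
                                    := (b :* ((s :* p) :+ (s :* q))) :+ (s :* r)) refl
    where open xor-∧-Solver

Untouched⇒≢ : {a b x : Fin n} → a ≢ b → Untouched x (a , b) → x ≢ a × x ≢ b
Untouched⇒≢ {a = a} {b} a≢b untouched =
  (λ { refl → case trans (sym untouched) (cong₂ _xor_ (==-refl a) (≢⇒==-false a≢b)) of λ () }) ,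
  (λ { refl → case trans (sym untouched) (cong₂ _xor_ (≢⇒==-false (a≢b ∘ sym)) (==-refl b)) of λ () })

neighbour-or-untouched : {A : Set} (f : Fin n → A) (L : Vec (Edge n) m) → All (EdgeInvariant f) L → (x : Fin n) →
                         (∃ λ w → w ≢ x × f w ≡ f x) ⊎ All (Untouched x) L
neighbour-or-untouched f [] [] x = inj₂ []
neighbour-or-untouched f ((u , v) ∷ L) (fu≡fv ∷ inv) x with x ≟ u | x ≟ v
... | yes refl | yes refl = Sum.map₂ (xor-same (x == x) ∷_) (neighbour-or-untouched f L inv x)
... | yes refl | no x≢v   = inj₁ (v , x≢v ∘ sym , sym fu≡fv)
... | no x≢u   | yes refl = inj₁ (u , x≢u ∘ sym , fu≡fv)
... | no x≢u   | no x≢v   =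
  Sum.map₂ (cong₂ _xor_ (≢⇒==-false x≢u) (≢⇒==-false x≢v) ∷_) (neighbour-or-untouched f L inv x)

-- Union–find, processing the edges from last to first: component L x is a representative of the
-- connected component of x in L.
relabel : (Fin n → Fin n) → Edge n → Fin n → Fin n
relabel l (u , v) x = if l x == l v then l u else l x

component : Vec (Edge n) m → Fin n → Fin n
component [] x = x
component (e ∷ L) = relabel (component L) e

-- the edges closing a cycle with the edges after them; the remaining ones form a spanning forest
nonForest : Vec (Edge n) m → Subset m
nonForest [] = []
nonForest ((u , v) ∷ L) = (component L u == component L v) ∷ nonForest L

module _ (l : Fin n → Fin n) (u v : Fin n) where

  relabel-joined : ∀ x → l x ≡ l v → relabel l (u , v) x ≡ l u
  relabel-joined x eq rewrite dec-true (l x ≟ l v) eq = refl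

  relabel-apart : ∀ x → l x ≢ l v → relabel l (u , v) x ≡ l x
  relabel-apart x neq rewrite dec-false (l x ≟ l v) neq = refl

  relabel-trivial : l u ≡ l v → ∀ x → relabel l (u , v) x ≡ l x
  relabel-trivial lu≡lv x with l x ≟ l v
  ... | yes lx≡lv = trans lu≡lv (sym lx≡lv)
  ... | no _      = refl

  relabel-joins : EdgeInvariant (relabel l (u , v)) (u , v)
  relabel-joins with l u ≟ l v
  ... | yes _ = sym (relabel-joined v refl)
  ... | no _  = sym (relabel-joined v refl)

  module _ (l-idem : ∀ x → l (l x) ≡ l x) where

    relabel-fixes : ∀ y → l y ≢ l v → relabel l (u , v) (l y) ≡ l y
    relabel-fixes y ly≢lv = trans (relabel-apart (l y) (ly≢lv ∘ trans (sym (l-idem y)))) (l-idem y)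

    relabel-idempotent : ∀ x → relabel l (u , v) (relabel l (u , v) x) ≡ relabel l (u , v) x
    relabel-idempotent x with l u ≟ l v
    ... | yes lu≡lv = trans (relabel-trivial lu≡lv _) (trans (cong l (relabel-trivial lu≡lv x))
                        (trans (l-idem x) (sym (relabel-trivial lu≡lv x))))
    ... | no lu≢lv with l x ≟ l v
    ...   | yes _    = relabel-fixes u lu≢lv
    ...   | no lx≢lv = relabel-fixes x lx≢lv

component-invariant : (L : Vec (Edge n) m) → All (EdgeInvariant (component L)) L
component-invariant [] = []
component-invariant ((u , v) ∷ L) =
  relabel-joins l u v ∷ All.map (cong (λ w → if w == l v then l u else w)) (component-invariant L)
  where
  l : Fin _ → Fin _
  l = component L

component-idempotent : (L : Vec (Edge n) m) → ∀ x → component L (component L x) ≡ component L x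
component-idempotent [] x = refl
component-idempotent ((u , v) ∷ L) = relabel-idempotent (component L) u v (component-idempotent L)

module ℕSum = CommutativeMonoidSum +-0-commutativeMonoid

𝟙 : Bool → ℕ
𝟙 b = if b then 1 else 0

#roots : (Fin n → Fin n) → ℕ
#roots l = ℕSum.sum (λ x → 𝟙 (l x == x))

sum-𝟙-== : (z : Fin n) → ℕSum.sum (λ x → 𝟙 (z == x)) ≡ 1
sum-𝟙-== z = trans (sum-supported +-0-commutativeMonoid _ z (λ x x≢z → cong 𝟙 (≢⇒==-false (x≢z ∘ sym))))
                   (cong 𝟙 (==-refl z))

#roots-id : ∀ n → #roots {n} (λ x → x) ≡ n
#roots-id n = trans (ℕSum.sum-cong-≗ {n} (cong 𝟙 ∘ ==-refl)) (sum-ones n)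
  where
  sum-ones : ∀ n → ℕSum.sum {n} (λ _ → 1) ≡ n
  sum-ones zero    = refl
  sum-ones (suc n) = cong suc (sum-ones n)

#roots-const : (l : Fin n → Fin n) (z : Fin n) → (∀ x → l x ≡ z) → #roots l ≡ 1
#roots-const l z l≡z = trans (ℕSum.sum-cong-≗ (λ x → cong (λ w → 𝟙 (w == x)) (l≡z x))) (sum-𝟙-== z)

#roots-relabel : (l : Fin n → Fin n) (u v : Fin n) → (∀ x → l (l x) ≡ l x) → l u ≢ l v →
                 #roots l ≡ suc (#roots (relabel l (u , v)))
#roots-relabel l u v l-idem lu≢lv = begin
  #roots l                                                 ≡⟨ ℕSum.sum-cong-≗ split ⟩
  ℕSum.sum (λ x → 𝟙 (l′ x == x) + 𝟙 (l v == x))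
    ≡⟨ ℕSum.∑-distrib-+ (λ x → 𝟙 (l′ x == x)) (λ x → 𝟙 (l v == x)) ⟩
  #roots l′ + ℕSum.sum (λ x → 𝟙 (l v == x))                ≡⟨ cong (#roots l′ +_) (sum-𝟙-== (l v)) ⟩
  #roots l′ + 1                                            ≡⟨ +-comm _ 1 ⟩
  suc (#roots l′)                                          ∎
  where
  open ≡-Reasoning
  l′ : Fin _ → Fin _
  l′ = relabel l (u , v)
  split : ∀ x → 𝟙 (l x == x) ≡ 𝟙 (l′ x == x) + 𝟙 (l v == x)
  split x with l v ≟ x
  ... | yes refl = begin
    𝟙 (l (l v) == l v)        ≡⟨ cong (λ w → 𝟙 (w == l v)) (l-idem v) ⟩
    𝟙 (l v == l v)            ≡⟨ cong 𝟙 (==-refl (l v)) ⟩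
    1                         ≡⟨ cong (λ b → 𝟙 b + 1) (≢⇒==-false lu≢lv) ⟨
    𝟙 (l u == l v) + 1        ≡⟨ cong (λ w → 𝟙 (w == l v) + 1) (relabel-joined l u v (l v) (l-idem v)) ⟨
    𝟙 (l′ (l v) == l v) + 1   ∎
  ... | no lv≢x with l x ≟ l v
  ...   | no _       = sym (+-identityʳ _)
  ...   | yes lx≡lv = trans (cong 𝟙 (≢⇒==-false (lv≢x ∘ trans (sym lx≡lv))))
                            (sym (cong (_+ 0) (cong 𝟙 (≢⇒==-false lu≢x))))
    where
    lu≢x : l u ≢ x
    lu≢x lu≡x = lu≢lv (trans (sym (l-idem u)) (trans (cong l lu≡x) lx≡lv))

-- every forest edge merges two components, every other edge leaves the components unchanged
#roots-component : (L : Vec (Edge n) m) → #roots (component L) + m ≡ n + ∣ nonForest L ∣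
#roots-component {n} [] = trans (+-identityʳ _) (trans (#roots-id n) (sym (+-identityʳ n)))
#roots-component {n} {suc m} ((u , v) ∷ L) with component L u ≟ component L v
... | yes lu≡lv = begin
  #roots (relabel l (u , v)) + suc m   ≡⟨ cong (_+ suc m) (ℕSum.sum-cong-≗ same-roots) ⟩
  #roots l + suc m                     ≡⟨ +-suc _ m ⟩
  suc (#roots l + m)                   ≡⟨ cong suc (#roots-component L) ⟩
  suc (n + ∣ nonForest L ∣)            ≡⟨ +-suc n _ ⟨
  n + suc ∣ nonForest L ∣              ∎
  where
  open ≡-Reasoning
  l : Fin _ → Fin _
  l = component L
  same-roots : ∀ x → 𝟙 (relabel l (u , v) x == x) ≡ 𝟙 (l x == x)
  same-roots x = cong (λ w → 𝟙 (w == x)) (relabel-trivial l u v lu≡lv x)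
... | no lu≢lv = begin
  #roots (relabel l (u , v)) + suc m   ≡⟨ +-suc _ m ⟩
  suc (#roots (relabel l (u , v))) + m ≡⟨ cong (_+ m) (#roots-relabel l u v (component-idempotent L) lu≢lv) ⟨
  #roots l + m                         ≡⟨ #roots-component L ⟩
  n + ∣ nonForest L ∣                  ∎
  where
  open ≡-Reasoning
  l : Fin _ → Fin _
  l = component L

connected⇒∣nonForest∣≡1 : (L : Vec (Edge n) n) (z : Fin n) → (∀ x → component L x ≡ component L z) →
                          ∣ nonForest L ∣ ≡ 1
connected⇒∣nonForest∣≡1 {n} L z connected = sym (+-cancelˡ-≡ n 1 _ (begin
  n + 1                               ≡⟨ +-comm n 1 ⟩
  1 + n                               ≡⟨ cong (_+ n) (#roots-const (component L) _ connected) ⟨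
  #roots (component L) + n            ≡⟨ #roots-component L ⟩
  n + ∣ nonForest L ∣                 ∎))
  where open ≡-Reasoning

crossing-forestEdge : (L : Vec (Edge n) m) {u v : Fin n} (b : Bool) (d : Subset m) →
                      component L u ≢ component L v →
                      crossing (λ x → component L x == component L u) (b ∷ d) ((u , v) ∷ L) ≡ b
crossing-forestEdge L {u} {v} b d lu≢lv
  rewrite ==-refl (component L u) | ≢⇒==-false (lu≢lv ∘ sym)
        | crossing-invariant {S = λ x → component L x == component L u} d L
            (All.map (cong (_== component L u)) (component-invariant L))
  = trans (xor-identityʳ _) (∧-identityʳ b)

-- The cut S = component of u (w.r.t. the later edges) is crossed by the forest edge (u , v) alone.
boundary-injective : (L : Vec (Edge n) m) {d e : Subset m} → (∀ x → boundary d L x ≡ boundary e L x) →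
                     nonForest L ∩ d ≡ nonForest L ∩ e → d ≡ e
boundary-injective [] {[]} {[]} _ _ = refl
boundary-injective {n} ((u , v) ∷ L) {b ∷ d} {b′ ∷ e} ∂≡ ∩≡ =
  cong₂ _∷_ b≡b′ (boundary-injective L tail-∂≡ (∷-injectiveʳ ∩≡))
  where
  S : Fin n → Bool
  S x = component L x == component L u

  head-bit : (c? : Dec (component L u ≡ component L v)) → does c? ∧ b ≡ does c? ∧ b′ → b ≡ b′
  head-bit (yes _)     eq = eq
  head-bit (no lu≢lv) _  = begin
    b                                          ≡⟨ crossing-forestEdge L b d lu≢lv ⟨
    crossing S (b ∷ d) ((u , v) ∷ L)            ≡⟨ parity-∧-boundary S (b ∷ d) ((u , v) ∷ L) ⟨
    parity (λ x → S x ∧ boundary (b ∷ d) ((u , v) ∷ L) x)     ≡⟨ Parity.sum-cong-≗ (λ x → cong (S x ∧_) (∂≡ x)) ⟩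
    parity (λ x → S x ∧ boundary (b′ ∷ e) ((u , v) ∷ L) x)    ≡⟨ parity-∧-boundary S (b′ ∷ e) ((u , v) ∷ L) ⟩
    crossing S (b′ ∷ e) ((u , v) ∷ L)           ≡⟨ crossing-forestEdge L b′ e lu≢lv ⟩
    b′                                         ∎
    where open ≡-Reasoning

  b≡b′ : b ≡ b′
  b≡b′ = head-bit (component L u ≟ component L v) (∷-injectiveˡ ∩≡)

  tail-∂≡ : ∀ x → boundary d L x ≡ boundary e L x
  tail-∂≡ x = xor-cancelˡ (b ∧ endpoint (u , v) x) _ _
    (trans (∂≡ x) (cong (λ b″ → (b″ ∧ endpoint (u , v) x) xor boundary e L x) (sym b≡b′)))

∣p∣≡0⇒p≡⊥ : (p : Subset n) → ∣ p ∣ ≡ 0 → p ≡ ⊥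
∣p∣≡0⇒p≡⊥ []            _   = refl
∣p∣≡0⇒p≡⊥ (false ∷ p) ∣p∣≡0 = cong (false ∷_) (∣p∣≡0⇒p≡⊥ p ∣p∣≡0)

∣p∣≡1⇒p∩q≡⊥⊎p : (p q : Subset n) → ∣ p ∣ ≡ 1 → p ∩ q ≡ ⊥ ⊎ p ∩ q ≡ p
∣p∣≡1⇒p∩q≡⊥⊎p (false ∷ p) (b ∷ q) ∣p∣≡1 with ∣p∣≡1⇒p∩q≡⊥⊎p p q ∣p∣≡1
... | inj₁ p∩q≡⊥ = inj₁ (cong (false ∷_) p∩q≡⊥)
... | inj₂ p∩q≡p = inj₂ (cong (false ∷_) p∩q≡p)
∣p∣≡1⇒p∩q≡⊥⊎p (true ∷ p) (b ∷ q) ∣p∣≡1 rewrite ∣p∣≡0⇒p≡⊥ p (suc-injective ∣p∣≡1) | ∩-zeroˡ q with b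
... | false = inj₁ refl
... | true  = inj₂ refl

forest-cycle≡⊥ : (L : Vec (Edge n) m) {d : Subset m} → IsCycle d L → nonForest L ∩ d ≡ ⊥ → d ≡ ⊥
forest-cycle≡⊥ L cycle N∩d≡⊥ =
  boundary-injective L (λ x → trans (cycle x) (sym (crossing-⊥ (x ==_) L)))
                       (trans N∩d≡⊥ (sym (∩-zeroʳ (nonForest L))))

unicyclic-cycles : (L : Vec (Edge n) m) {d e : Subset m} → ∣ nonForest L ∣ ≡ 1 →
                   IsCycle d L → IsCycle e L → e ≢ ⊥ → d ≡ ⊥ ⊎ d ≡ e
unicyclic-cycles L {d} {e} one d-cycle e-cycle e≢⊥
  with ∣p∣≡1⇒p∩q≡⊥⊎p (nonForest L) d one | ∣p∣≡1⇒p∩q≡⊥⊎p (nonForest L) e one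
... | _          | inj₁ N∩e≡⊥ = contradiction (forest-cycle≡⊥ L e-cycle N∩e≡⊥) e≢⊥
... | inj₁ N∩d≡⊥ | inj₂ _     = inj₁ (forest-cycle≡⊥ L d-cycle N∩d≡⊥)
... | inj₂ N∩d≡N | inj₂ N∩e≡N = inj₂ (boundary-injective L (λ x → trans (d-cycle x) (sym (e-cycle x)))
                                    (trans N∩d≡N (sym N∩e≡N)))

swap : Fin n → Fin n → Fin n → Fin n
swap a b x with x ≟ a | x ≟ b
... | yes _ | _     = b
... | no _  | yes _ = a
... | no _  | no _  = x

module _ (a b : Fin n) where

  swap-fst : swap a b a ≡ b
  swap-fst with a ≟ a
  ... | yes _    = refl
  ... | no a≢a = contradiction refl a≢a

  swap-snd : swap a b b ≡ a
  swap-snd with b ≟ a | b ≟ b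
  ... | yes b≡a | _       = b≡a
  ... | no _    | yes _   = refl
  ... | no _    | no b≢b = contradiction refl b≢b

  swap-other : ∀ {x} → x ≢ a → x ≢ b → swap a b x ≡ x
  swap-other {x} x≢a x≢b with x ≟ a | x ≟ b
  ... | yes x≡a | _       = contradiction x≡a x≢a
  ... | no _    | yes x≡b = contradiction x≡b x≢b
  ... | no _    | no _    = refl

  swap-involutive : ∀ x → swap a b (swap a b x) ≡ x
  swap-involutive x with x ≟ a | x ≟ b
  ... | yes refl | _        = swap-snd
  ... | no _     | yes refl = swap-fst
  ... | no x≢a   | no x≢b   = swap-other x≢a x≢b

  ==-swap : ∀ x y → (x == swap a b y) ≡ (swap a b x == y)
  ==-swap x y with x ≟ swap a b y
  ... | yes refl = sym (dec-true (swap a b x ≟ y) (swap-involutive y))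
  ... | no x≢σy  = sym (dec-false (swap a b x ≟ y)
                         (λ σx≡y → x≢σy (trans (sym (swap-involutive x)) (cong (swap a b) σx≡y))))

  endpoint-mapEdge-swap : ∀ e x → endpoint (mapEdge (swap a b) e) x ≡ endpoint e (swap a b x)
  endpoint-mapEdge-swap (u , v) x = cong₂ _xor_ (==-swap x u) (==-swap x v)

  endpoint-swap : ∀ x → endpoint (a , b) (swap a b x) ≡ endpoint (a , b) x
  endpoint-swap x = begin
    (swap a b x == a) xor (swap a b x == b)   ≡⟨ cong₂ _xor_ (==-swap x a) (==-swap x b) ⟨
    (x == swap a b a) xor (x == swap a b b)   ≡⟨ cong₂ (λ a′ b′ → (x == a′) xor (x == b′)) swap-fst swap-snd ⟩
    (x == b) xor (x == a)                     ≡⟨ xor-comm (x == b) (x == a) ⟩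
    (x == a) xor (x == b)                     ∎
    where open ≡-Reasoning

swap-invariant : {A : Set} (f : Fin n → A) {a b : Fin n} → f a ≡ f b → ∀ x → f (swap a b x) ≡ f x
swap-invariant f {a} {b} fa≡fb x with x ≟ a | x ≟ b
... | yes x≡a | _       = trans (sym fa≡fb) (cong f (sym x≡a))
... | no _    | yes x≡b = trans fa≡fb (cong f (sym x≡b))
... | no _    | no _    = refl

boundary-mapEdge-swap : (a b : Fin n) (d : Subset m) (L : Vec (Edge n) m) (x : Fin n) →
                        boundary d (map (mapEdge (swap a b)) L) x ≡ boundary d L (swap a b x)
boundary-mapEdge-swap a b [] [] x = refl
boundary-mapEdge-swap a b (t ∷ d) (e ∷ L) x =
  cong₂ (λ ε ∂ → (t ∧ ε) xor ∂) (endpoint-mapEdge-swap a b e x) (boundary-mapEdge-swap a b d L x)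

flipSigns : (Fin n → Bool) → SFin n → SFin n
flipSigns S y = if S (absS y) then minus y else y

mapAbs : (Fin n → Fin n) → SFin n → SFin n
mapAbs f (pos x) = pos (f x)
mapAbs f (neg x) = neg (f x)

absS-minus : (y : SFin n) → absS (minus y) ≡ absS y
absS-minus (pos _) = refl
absS-minus (neg _) = refl

minus-involutive : (y : SFin n) → minus (minus y) ≡ y
minus-involutive (pos _) = refl
minus-involutive (neg _) = refl

absS-flipSigns : (S : Fin n → Bool) (y : SFin n) → absS (flipSigns S y) ≡ absS y
absS-flipSigns S y with S (absS y)
... | true  = absS-minus y
... | false = refl

absS-mapAbs : (f : Fin n → Fin n) (y : SFin n) → absS (mapAbs f y) ≡ f (absS y)
absS-mapAbs f (pos _) = refl
absS-mapAbs f (neg _) = refl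

flipSigns-cong : {S T : Fin n → Bool} → (∀ x → S x ≡ T x) → ∀ y → flipSigns S y ≡ flipSigns T y
flipSigns-cong S≗T y = cong (λ s → if s then minus y else y) (S≗T (absS y))

flipSigns-∘ : (S T : Fin n → Bool) (y : SFin n) → flipSigns S (flipSigns T y) ≡ flipSigns (λ x → S x xor T x) y
flipSigns-∘ S T y rewrite absS-flipSigns T y with S (absS y) | T (absS y)
... | true  | true  = minus-involutive y
... | true  | false = refl
... | false | _     = refl

flipSigns-comm : (S T : Fin n → Bool) (y : SFin n) → flipSigns S (flipSigns T y) ≡ flipSigns T (flipSigns S y)
flipSigns-comm S T y = trans (flipSigns-∘ S T y)
  (trans (flipSigns-cong (λ x → xor-comm (S x) (T x)) y) (sym (flipSigns-∘ T S y)))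

flipSigns-involutive : (S : Fin n → Bool) (y : SFin n) → flipSigns S (flipSigns S y) ≡ y
flipSigns-involutive S y = trans (flipSigns-∘ S S y) (flipSigns-cong (λ x → xor-same (S x)) y)

flipSigns-fixes-pos : (S : Fin n → Bool) (x : Fin n) → flipSigns S (pos x) ≡ pos x → S x ≡ false
flipSigns-fixes-pos S x eq with S x
... | false = refl
... | true  = case eq of λ ()

mapAbs-involutive : (f : Fin n → Fin n) → (∀ x → f (f x) ≡ x) → ∀ y → mapAbs f (mapAbs f y) ≡ y
mapAbs-involutive f f-invol (pos x) = cong pos (f-invol x)
mapAbs-involutive f f-invol (neg x) = cong neg (f-invol x)

mapAbs-flipSigns : (f : Fin n → Fin n) (S T : Fin n → Bool) → (∀ x → T (f x) ≡ S x) →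
                   ∀ y → mapAbs f (flipSigns S y) ≡ flipSigns T (mapAbs f y)
mapAbs-flipSigns f S T Tf≗S (pos x) rewrite Tf≗S x with S x
... | true  = refl
... | false = refl
mapAbs-flipSigns f S T Tf≗S (neg x) rewrite Tf≗S x with S x
... | true  = refl
... | false = refl

negateAt : Fin n → SFin n → SFin n
negateAt z = flipSigns (_== z)

negateAt-away : (z : Fin n) (y : SFin n) → absS y ≢ z → negateAt z y ≡ y
negateAt-away z y |y|≢z = cong (λ s → if s then minus y else y) (≢⇒==-false |y|≢z)

absS≡⇒ : {y : SFin n} {x : Fin n} → absS y ≡ x → y ≡ pos x ⊎ y ≡ neg x
absS≡⇒ {y = pos _} refl = inj₁ refl
absS≡⇒ {y = neg _} refl = inj₂ refl

perm : Refl n → Fin n → Fin n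
perm (reflection a b _ _) = swap a b

signs : Refl n → Fin n → Bool
signs (reflection a b _ t) x = t ∧ endpoint (a , b) x

actR-normal : (r : Refl n) (y : SFin n) → actR r y ≡ mapAbs (perm r) (flipSigns (signs r) y)
actR-normal (reflection a b _ false) (pos x) with x ≟ a | x ≟ b
... | yes _ | _     = refl
... | no _  | yes _ = refl
... | no _  | no _  = refl
actR-normal (reflection a b _ false) (neg x) with x ≟ a | x ≟ b
... | yes _ | _     = refl
... | no _  | yes _ = refl
... | no _  | no _  = refl
actR-normal (reflection a b a<b true) (pos x) with x ≟ a | x ≟ b
... | yes x≡a | yes x≡b = contradiction (trans (sym x≡a) x≡b) (<⇒≢ a<b)
... | yes x≡a | no _    = cong neg (sym (trans (cong (swap a b) x≡a) (swap-fst a b)))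
... | no _    | yes x≡b = cong neg (sym (trans (cong (swap a b) x≡b) (swap-snd a b)))
... | no x≢a  | no x≢b  = cong pos (sym (swap-other a b x≢a x≢b))
actR-normal (reflection a b a<b true) (neg x) with x ≟ a | x ≟ b
... | yes x≡a | yes x≡b = contradiction (trans (sym x≡a) x≡b) (<⇒≢ a<b)
... | yes x≡a | no _    = cong pos (sym (trans (cong (swap a b) x≡a) (swap-fst a b)))
... | no _    | yes x≡b = cong pos (sym (trans (cong (swap a b) x≡b) (swap-snd a b)))
... | no x≢a  | no x≢b  = cong neg (sym (swap-other a b x≢a x≢b))

perm-involutive : (r : Refl n) (x : Fin n) → perm r (perm r x) ≡ x
perm-involutive (reflection a b _ _) = swap-involutive a b

signs-perm : (r : Refl n) (x : Fin n) → signs r (perm r x) ≡ signs r x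
signs-perm (reflection a b _ t) x = cong (t ∧_) (endpoint-swap a b x)

absS-actR : (r : Refl n) (y : SFin n) → absS (actR r y) ≡ perm r (absS y)
absS-actR r y = trans (cong absS (actR-normal r y))
  (trans (absS-mapAbs (perm r) (flipSigns (signs r) y)) (cong (perm r) (absS-flipSigns (signs r) y)))

actR-involutive : (r : Refl n) (y : SFin n) → actR r (actR r y) ≡ y
actR-involutive r y = begin
  actR r (actR r y)                          ≡⟨ actR-normal r (actR r y) ⟩
  mapAbs π (flipSigns σ (actR r y))          ≡⟨ cong (mapAbs π ∘ flipSigns σ) (actR-normal r y) ⟩
  mapAbs π (flipSigns σ (mapAbs π (flipSigns σ y)))
    ≡⟨ cong (mapAbs π) (mapAbs-flipSigns π σ σ (signs-perm r) (flipSigns σ y)) ⟨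
  mapAbs π (mapAbs π (flipSigns σ (flipSigns σ y)))
    ≡⟨ mapAbs-involutive π (perm-involutive r) _ ⟩
  flipSigns σ (flipSigns σ y)                ≡⟨ flipSigns-involutive σ y ⟩
  y                                          ∎
  where
  open ≡-Reasoning
  π : Fin _ → Fin _
  π = perm r
  σ : Fin _ → Bool
  σ = signs r

actR-flipSigns : (r : Refl n) (S : Fin n → Bool) (y : SFin n) →
                 actR r (flipSigns S y) ≡ flipSigns (S ∘ perm r) (actR r y)
actR-flipSigns r S y = begin
  actR r (flipSigns S y)                     ≡⟨ actR-normal r (flipSigns S y) ⟩
  mapAbs π (flipSigns σ (flipSigns S y))     ≡⟨ cong (mapAbs π) (flipSigns-comm σ S y) ⟩
  mapAbs π (flipSigns S (flipSigns σ y))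
    ≡⟨ mapAbs-flipSigns π S (S ∘ π) (cong S ∘ perm-involutive r) (flipSigns σ y) ⟩
  flipSigns (S ∘ π) (mapAbs π (flipSigns σ y)) ≡⟨ cong (flipSigns (S ∘ π)) (actR-normal r y) ⟨
  flipSigns (S ∘ π) (actR r y)               ∎
  where
  open ≡-Reasoning
  π : Fin _ → Fin _
  π = perm r
  σ : Fin _ → Bool
  σ = signs r

perm-fixes : (r : Refl n) {x : Fin n} → Untouched x (chord r) → perm r x ≡ x
perm-fixes (reflection a b a<b _) untouched =
  let x≢a , x≢b = Untouched⇒≢ (<⇒≢ a<b) untouched in swap-other a b x≢a x≢b

actR-fixes : (r : Refl n) {x : Fin n} → Untouched x (chord r) → actR r (pos x) ≡ pos x
actR-fixes (reflection a b a<b t) {x} εx≡false with Untouched⇒≢ (<⇒≢ a<b) εx≡false | t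
... | x≢a , x≢b | false rewrite dec-no (x ≟ a) x≢a | dec-no (x ≟ b) x≢b = refl
... | x≢a , x≢b | true  rewrite dec-no (x ≟ a) x≢a | dec-no (x ≟ b) x≢b = refl

endpoint-mapEdge-perm : (r : Refl n) {x : Fin n} → Untouched x (chord r) →
                        ∀ e → endpoint (mapEdge (perm r) e) x ≡ endpoint e x
endpoint-mapEdge-perm r@(reflection a b _ _) {x} εx≡false e =
  trans (endpoint-mapEdge-swap a b e x) (cong (endpoint e) (perm-fixes r {x} εx≡false))

toggleBy : Bool → Refl n → Refl n
toggleBy b (reflection a c a<c t) = reflection a c a<c (b xor t)

actR-toggleBy : (b : Bool) (r : Refl n) (y : SFin n) →
                actR (toggleBy b r) y ≡ flipSigns (λ x → b ∧ endpoint (chord r) x) (actR r y)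
actR-toggleBy b r@(reflection a c _ t) y = begin
  actR (toggleBy b r) y                        ≡⟨ actR-normal (toggleBy b r) y ⟩
  mapAbs π (flipSigns (λ x → (b xor t) ∧ ε x) y)
    ≡⟨ cong (mapAbs π) (flipSigns-cong (λ x → ∧-distribʳ-xor (ε x) b t) y) ⟩
  mapAbs π (flipSigns (λ x → (b ∧ ε x) xor (t ∧ ε x)) y)
    ≡⟨ cong (mapAbs π) (flipSigns-∘ bε (signs r) y) ⟨
  mapAbs π (flipSigns bε (flipSigns (signs r) y))
    ≡⟨ mapAbs-flipSigns π bε bε (cong (b ∧_) ∘ endpoint-swap a c) _ ⟩
  flipSigns bε (mapAbs π (flipSigns (signs r) y)) ≡⟨ cong (flipSigns bε) (actR-normal r y) ⟨
  flipSigns bε (actR r y)                      ∎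
  where
  open ≡-Reasoning
  π : Fin _ → Fin _
  π = swap a c
  ε : Fin _ → Bool
  ε = endpoint (a , c)
  bε : Fin _ → Bool
  bε x = b ∧ ε x

touches : Fin n → Refl n → Bool
touches z r = endpoint (chord r) z

actR-negateAt : (z : Fin n) (r : Refl n) (y : SFin n) →
                actR (toggleBy (touches z r) r) (negateAt z y) ≡ negateAt z (actR r y)
actR-negateAt z r@(reflection a b a<b _) y = begin
  actR (toggleBy εz r) (negateAt z y)
    ≡⟨ actR-toggleBy εz r _ ⟩
  flipSigns εzε (actR r (negateAt z y))
    ≡⟨ cong (flipSigns εzε) (actR-flipSigns r (_== z) y) ⟩
  flipSigns εzε (flipSigns (λ x → swap a b x == z) (actR r y))
    ≡⟨ flipSigns-∘ εzε (λ x → swap a b x == z) (actR r y) ⟩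
  flipSigns (λ x → (εz ∧ ε x) xor (swap a b x == z)) (actR r y)
    ≡⟨ flipSigns-cong pointwise (actR r y) ⟩
  negateAt z (actR r y)
    ∎
  where
  open ≡-Reasoning
  ε : Fin _ → Bool
  ε = endpoint (a , b)
  εz : Bool
  εz = ε z
  εzε : Fin _ → Bool
  εzε x = εz ∧ ε x
  pointwise : ∀ x → (εz ∧ ε x) xor (swap a b x == z) ≡ (x == z)
  pointwise x rewrite sym (==-swap a b x z) with z ≟ a | z ≟ b
  ... | yes z≡a | yes z≡b = contradiction (trans (sym z≡a) z≡b) (<⇒≢ a<b)
  ... | yes refl | no _   = cancel (x == a) (x == b)
    where cancel : ∀ p q → (p xor q) xor q ≡ p
          cancel = solve 2 (λ p q → (p :+ q) :+ q := p) refl where open xor-∧-Solver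
  ... | no _ | yes refl   = cancel (x == a) (x == b)
    where cancel : ∀ p q → (p xor q) xor p ≡ q
          cancel = solve 2 (λ p q → (p :+ q) :+ p := q) refl where open xor-∧-Solver
  ... | no _ | no _       = refl

toggleAt : Subset m → Vec (Refl n) m → Vec (Refl n) m
toggleAt = zipWith toggleBy

-- position i holds the chord of the reflection (r₁ ⋯ rᵢ₋₁) rᵢ (r₁ ⋯ rᵢ₋₁)⁻¹
conjChords : Vec (Refl n) m → Vec (Edge n) m
conjChords [] = []
conjChords (r ∷ rs) = chord r ∷ map (mapEdge (perm r)) (conjChords rs)

prodR-toggleAt : (d : Subset m) (rs : Vec (Refl n) m) (y : SFin n) →
                 prodR (toggleAt d rs) y ≡ flipSigns (boundary d (conjChords rs)) (prodR rs y)
prodR-toggleAt [] [] y = refl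
prodR-toggleAt (b ∷ d) (r@(reflection a c _ _) ∷ rs) y = begin
  actR (toggleBy b r) (prodR (toggleAt d rs) y)
    ≡⟨ cong (actR (toggleBy b r)) (prodR-toggleAt d rs y) ⟩
  actR (toggleBy b r) (flipSigns ∂ (prodR rs y))
    ≡⟨ actR-toggleBy b r _ ⟩
  flipSigns bε (actR r (flipSigns ∂ (prodR rs y)))
    ≡⟨ cong (flipSigns bε) (actR-flipSigns r ∂ (prodR rs y)) ⟩
  flipSigns bε (flipSigns (∂ ∘ swap a c) (prodR (r ∷ rs) y))
    ≡⟨ flipSigns-∘ bε (∂ ∘ swap a c) _ ⟩
  flipSigns (λ x → bε x xor ∂ (swap a c x)) (prodR (r ∷ rs) y)
    ≡⟨ flipSigns-cong (λ x → cong (bε x xor_) (boundary-mapEdge-swap a c d (conjChords rs) x)) _ ⟨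
  flipSigns (boundary (b ∷ d) (conjChords (r ∷ rs))) (prodR (r ∷ rs) y)
    ∎
  where
  open ≡-Reasoning
  ∂ : Fin _ → Bool
  ∂ = boundary d (conjChords rs)
  bε : Fin _ → Bool
  bε x = b ∧ endpoint (a , c) x

prodR-surjective : (rs : Vec (Refl n) m) (z : SFin n) → ∃ λ y → prodR rs y ≡ z
prodR-surjective [] z = z , refl
prodR-surjective (r ∷ rs) z with prodR-surjective rs (actR r z)
... | y , eq = y , trans (cong (actR r) eq) (actR-involutive r z)

toggleAt-MinFact⇒IsCycle : {c : SFin n → SFin n} (d : Subset n) (rs : Vec (Refl n) n) →
                           MinFact n c rs → MinFact n c (toggleAt d rs) → IsCycle d (conjChords rs)
toggleAt-MinFact⇒IsCycle {c = c} d rs mf mf′ x with prodR-surjective rs (pos x)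
... | y , eq = flipSigns-fixes-pos ∂ x (begin
  flipSigns ∂ (pos x)               ≡⟨ cong (flipSigns ∂) eq ⟨
  flipSigns ∂ (prodR rs y)          ≡⟨ prodR-toggleAt d rs y ⟨
  prodR (toggleAt d rs) y           ≡⟨ mf′ y ⟩
  c y                               ≡⟨ mf y ⟨
  prodR rs y                        ≡⟨ eq ⟩
  pos x                             ∎)
  where
  open ≡-Reasoning
  ∂ : Fin _ → Bool
  ∂ = boundary d (conjChords rs)

isPlusRoot : Refl n → Bool
isPlusRoot (reflection _ _ _ t) = t

rootDifference : Vec (Refl n) m → Vec (Refl n) m → Subset m
rootDifference = zipWith (λ s r → isPlusRoot s xor isPlusRoot r)

same-chord⇒toggleBy : (s r : Refl n) → chord s ≡ chord r → s ≡ toggleBy (isPlusRoot s xor isPlusRoot r) r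
same-chord⇒toggleBy (reflection a b a<b t) (reflection .a .b a<b′ t′) refl =
  cong₂ (reflection a b) (<-irrelevant a<b a<b′)
    (sym (trans (xor-assoc t t′ t′) (trans (cong (t xor_) (xor-same t′)) (xor-identityʳ t))))

same-diagram⇒toggleAt : (ss rs : Vec (Refl n) m) → diagram ss ≡ diagram rs → ss ≡ toggleAt (rootDifference ss rs) rs
same-diagram⇒toggleAt [] [] _ = refl
same-diagram⇒toggleAt (s ∷ ss) (r ∷ rs) eq =
  cong₂ _∷_ (same-chord⇒toggleBy s r (∷-injectiveˡ eq)) (same-diagram⇒toggleAt ss rs (∷-injectiveʳ eq))

diagram-toggleAt : (d : Subset m) (rs : Vec (Refl n) m) → diagram (toggleAt d rs) ≡ diagram rs
diagram-toggleAt [] [] = refl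
diagram-toggleAt (b ∷ d) (reflection a c _ _ ∷ rs) = cong ((a , c) ∷_) (diagram-toggleAt d rs)

toggleAt-⊥ : (rs : Vec (Refl n) m) → toggleAt ⊥ rs ≡ rs
toggleAt-⊥ [] = refl
toggleAt-⊥ (reflection _ _ _ _ ∷ rs) = cong (_ ∷_) (toggleAt-⊥ rs)

toggleAt≡⇒≡⊥ : (d : Subset m) (rs : Vec (Refl n) m) → toggleAt d rs ≡ rs → d ≡ ⊥
toggleAt≡⇒≡⊥ [] [] _ = refl
toggleAt≡⇒≡⊥ (b ∷ d) (r ∷ rs) eq =
  cong₂ _∷_ (toggleBy-fixed b r (∷-injectiveˡ eq)) (toggleAt≡⇒≡⊥ d rs (∷-injectiveʳ eq))
  where
  toggleBy-fixed : ∀ b r → toggleBy b r ≡ r → b ≡ false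
  toggleBy-fixed false _                          _  = refl
  toggleBy-fixed true  (reflection _ _ _ false) ()
  toggleBy-fixed true  (reflection _ _ _ true)  ()

prodR-negateAt : (z : Fin n) (rs : Vec (Refl n) m) (y : SFin n) →
                 prodR (toggleAt (map (touches z) rs) rs) (negateAt z y) ≡ negateAt z (prodR rs y)
prodR-negateAt z [] y = refl
prodR-negateAt z (r ∷ rs) y =
  trans (cong (actR (toggleBy (touches z r) r)) (prodR-negateAt z rs y)) (actR-negateAt z r (prodR rs y))

prodR-fixes : (rs : Vec (Refl n) m) {x : Fin n} → All (Untouched x) (conjChords rs) → prodR rs (pos x) ≡ pos x
prodR-fixes [] _ = refl
prodR-fixes (r ∷ rs) {x} (εx≡false ∷ untouched) =
  trans (cong (actR r) (prodR-fixes rs (All.map (λ {e} → trans (sym (endpoint-mapEdge-perm r {x} εx≡false e)))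
                                                 (map⁻ untouched))))
        (actR-fixes r εx≡false)

untouched⇒conjChords-untouched : (rs : Vec (Refl n) m) {x : Fin n} →
                                 map (touches x) rs ≡ ⊥ → All (Untouched x) (conjChords rs)
untouched⇒conjChords-untouched [] _ = []
untouched⇒conjChords-untouched (r ∷ rs) {x} eq = ∷-injectiveˡ eq ∷ map⁺
  (All.map (λ {e} → trans (endpoint-mapEdge-perm r {x} (∷-injectiveˡ eq) e))
           (untouched⇒conjChords-untouched rs {x} (∷-injectiveʳ eq)))

absS-prodR-invariant : {A : Set} (rs : Vec (Refl n) m) (f : Fin n → A) → All (EdgeInvariant f) (conjChords rs) →
                       ∀ y → f (absS (prodR rs y)) ≡ f (absS y)
absS-prodR-invariant [] f _ y = refl
absS-prodR-invariant (r@(reflection a b _ _) ∷ rs) f (fa≡fb ∷ invariant) y = begin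
  f (absS (actR r (prodR rs y)))   ≡⟨ cong f (absS-actR r (prodR rs y)) ⟩
  f (swap a b (absS (prodR rs y))) ≡⟨ absS-prodR-invariant rs (f ∘ swap a b) (map⁻ invariant) y ⟩
  f (swap a b (absS y))            ≡⟨ swap-invariant f fa≡fb (absS y) ⟩
  f (absS y)                       ∎
  where open ≡-Reasoning

injective⇒surjective : {f : Fin n → Fin n} → Injective _≡_ _≡_ f → ∀ y → ∃ λ x → f x ≡ y
injective⇒surjective {suc n} {f} f-injective y with any? (λ x → f x ≟ y)
... | yes hit = hit
... | no miss = contradiction (injective⇒≤ g-injective) 1+n≰n
  where
  y≢f : ∀ x → y ≢ f x
  y≢f x y≡fx = miss (x , sym y≡fx)
  g : Fin (suc n) → Fin n
  g x = punchOut (y≢f x)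
  g-injective : Injective _≡_ _≡_ g
  g-injective {x} {x′} eq = f-injective (punchOut-injective (y≢f x) (y≢f x′) eq)

next-inject₁ : ∀ {j} (i : Fin j) → next (inject₁ i) ≡ suc i
next-inject₁ {suc j}       zero    = refl
next-inject₁ {suc (suc j)} (suc i) rewrite next-inject₁ {suc j} i = refl

next-invariant⇒constant : ∀ {j} {A : Set} (g : Fin (suc j) → A) → (∀ i → g (next i) ≡ g i) → ∀ i → g i ≡ g zero
next-invariant⇒constant g g-invariant = <-weakInduction (λ i → g i ≡ g zero) refl
  (λ i gi≡g0 → trans (cong g (sym (next-inject₁ i))) (trans (g-invariant (inject₁ i)) gi≡g0))

module _ {p : ℕ} where

  -- enumerates ±2, …, ±(p+2); ±1 go to the junk value zero
  nonzeroIndex : SFin (suc (suc p)) → Fin (suc p + suc p)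
  nonzeroIndex (pos zero)    = zero
  nonzeroIndex (neg zero)    = zero
  nonzeroIndex (pos (suc a)) = a ↑ˡ suc p
  nonzeroIndex (neg (suc a)) = suc p ↑ʳ a

  fromNonzeroIndex : Fin (suc p + suc p) → SFin (suc (suc p))
  fromNonzeroIndex i = Sum.[ pos ∘ suc , neg ∘ suc ]′ (splitAt (suc p) i)

  fromNonzeroIndex-nonzeroIndex : ∀ y → absS y ≢ zero → fromNonzeroIndex (nonzeroIndex y) ≡ y
  fromNonzeroIndex-nonzeroIndex (pos zero)    y≢0 = contradiction refl y≢0
  fromNonzeroIndex-nonzeroIndex (neg zero)    y≢0 = contradiction refl y≢0
  fromNonzeroIndex-nonzeroIndex (pos (suc a)) _   rewrite splitAt-↑ˡ (suc p) a (suc p) = refl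
  fromNonzeroIndex-nonzeroIndex (neg (suc a)) _   rewrite splitAt-↑ʳ (suc p) (suc p) a = refl

  injective-nonzero⇒covers : (k : Fin (suc p + suc p) → SFin (suc (suc p))) → Injective _≡_ _≡_ k →
                             (∀ i → absS (k i) ≢ zero) → ∀ a → ∃ λ i → k i ≡ pos (suc a)
  injective-nonzero⇒covers k k-injective k-nonzero a =
    let i , eq = injective⇒surjective index∘k-injective (nonzeroIndex (pos (suc a)))
    in i , trans (sym (decode i))
                 (trans (cong fromNonzeroIndex eq) (fromNonzeroIndex-nonzeroIndex (pos (suc a)) λ ()))
    where
    decode : ∀ i → fromNonzeroIndex (nonzeroIndex (k i)) ≡ k i
    decode i = fromNonzeroIndex-nonzeroIndex (k i) (k-nonzero i)
    index∘k-injective : Injective _≡_ _≡_ (nonzeroIndex ∘ k)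
    index∘k-injective {i} {j} eq =
      k-injective (trans (sym (decode i)) (trans (cong fromNonzeroIndex eq) (decode j)))

module _ {p : ℕ} {c : SFin (suc (suc p)) → SFin (suc (suc p))} (c∈Dn : InDn (suc (suc p)) c)
         {k : Fin (suc p + suc p) → SFin (suc (suc p))} (cycleType : HasCycleType p c k) where

  open InDn c∈Dn using (injective)
  open HasCycleType cycleType

  c-avoids-±1 : ∀ y → absS y ≢ zero → absS (c y) ≢ zero
  c-avoids-±1 y |y|≢0 |cy|≡0 with absS≡⇒ |cy|≡0
  ... | inj₁ cy≡1  = |y|≢0 (cong absS (injective (trans cy≡1 (sym c-minusone))))
  ... | inj₂ cy≡-1 = |y|≢0 (cong absS (injective (trans cy≡-1 (sym c-one))))

  c-negateAt-zero : ∀ y → c (negateAt zero y) ≡ negateAt zero (c y)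
  c-negateAt-zero (pos zero)    = trans c-minusone (cong (negateAt zero) (sym c-one))
  c-negateAt-zero (neg zero)    = trans c-one (cong (negateAt zero) (sym c-minusone))
  c-negateAt-zero (pos (suc a)) = sym (negateAt-away zero _ (c-avoids-±1 (pos (suc a)) λ ()))
  c-negateAt-zero (neg (suc a)) = sym (negateAt-away zero _ (c-avoids-±1 (neg (suc a)) λ ()))

  module _ {rs : Vec (Refl (suc (suc p))) (suc (suc p))} (mf : MinFact _ c rs) where

    movers : Subset (suc (suc p))
    movers = map (touches zero) rs

    partner : Vec (Refl (suc (suc p))) (suc (suc p))
    partner = toggleAt movers rs

    partner-MinFact : MinFact _ c partner
    partner-MinFact x = begin
      prodR partner x                                   ≡⟨ cong (prodR partner) (flipSigns-involutive (_== zero) x) ⟨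
      prodR partner (negateAt zero (negateAt zero x))   ≡⟨ prodR-negateAt zero rs (negateAt zero x) ⟩
      negateAt zero (prodR rs (negateAt zero x))        ≡⟨ cong (negateAt zero) (mf (negateAt zero x)) ⟩
      negateAt zero (c (negateAt zero x))               ≡⟨ cong (negateAt zero) (c-negateAt-zero x) ⟩
      negateAt zero (negateAt zero (c x))               ≡⟨ flipSigns-involutive (_== zero) (c x) ⟩
      c x                                               ∎
      where open ≡-Reasoning

    moves-one : ¬ All (Untouched zero) (conjChords rs)
    moves-one untouched = case trans (sym (prodR-fixes rs untouched)) (trans (mf (pos zero)) c-one) of λ ()

    movers≢⊥ : movers ≢ ⊥
    movers≢⊥ = moves-one ∘ untouched⇒conjChords-untouched rs {zero}

    partner≢rs : partner ≢ rs
    partner≢rs = movers≢⊥ ∘ toggleAt≡⇒≡⊥ movers rs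

    L : Vec (Edge (suc (suc p))) (suc (suc p))
    L = conjChords rs

    l : Fin (suc (suc p)) → Fin (suc (suc p))
    l = component L

    component-k : ∀ i → l (absS (k i)) ≡ l (absS (k zero))
    component-k = next-invariant⇒constant (l ∘ absS ∘ k) λ i → begin
      l (absS (k (next i)))     ≡⟨ cong (l ∘ absS) (c-cycle i) ⟨
      l (absS (c (k i)))        ≡⟨ cong (l ∘ absS) (mf (k i)) ⟨
      l (absS (prodR rs (k i))) ≡⟨ absS-prodR-invariant rs l (component-invariant L) (k i) ⟩
      l (absS (k i))            ∎
      where open ≡-Reasoning

    component-suc : ∀ a → l (suc a) ≡ l (absS (k zero))
    component-suc a =
      let i , ki≡a = injective-nonzero⇒covers k k-distinct k-range a
      in trans (cong (l ∘ absS) (sym ki≡a)) (component-k i)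

    connected : ∀ x → l x ≡ l zero
    connected zero    = refl
    connected (suc a) with neighbour-or-untouched l L (component-invariant L) zero
    ... | inj₁ (zero  , w≢0 , _)      = contradiction refl w≢0
    ... | inj₁ (suc b , _ , lw≡l0)    = trans (component-suc a) (trans (sym (component-suc b)) lw≡l0)
    ... | inj₂ untouched              = contradiction untouched moves-one

    unicyclic : ∣ nonForest L ∣ ≡ 1
    unicyclic = connected⇒∣nonForest∣≡1 L zero connected

    movers-cycle : IsCycle movers L
    movers-cycle = toggleAt-MinFact⇒IsCycle movers rs mf partner-MinFact

    same-diagram⇒rs⊎partner : ∀ ss → MinFact _ c ss → diagram ss ≡ diagram rs → ss ≡ rs ⊎ ss ≡ partner
    same-diagram⇒rs⊎partner ss mf-ss same =
      Sum.map (λ d≡⊥ → trans ss≡ (trans (cong (λ d → toggleAt d rs) d≡⊥) (toggleAt-⊥ rs)))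
              (λ d≡movers → trans ss≡ (cong (λ d → toggleAt d rs) d≡movers))
              (unicyclic-cycles L unicyclic d-cycle movers-cycle movers≢⊥)
      where
      d : Subset (suc (suc p))
      d = rootDifference ss rs
      ss≡ : ss ≡ toggleAt d rs
      ss≡ = same-diagram⇒toggleAt ss rs same
      d-cycle : IsCycle d L
      d-cycle = toggleAt-MinFact⇒IsCycle d rs mf (subst (MinFact _ c) ss≡ mf-ss)

lemma4p1 : (p : ℕ) (c : SFin (suc (suc p)) → SFin (suc (suc p)))
    → InDn (suc (suc p)) c
    → (k : Fin (suc p + suc p) → SFin (suc (suc p))) → HasCycleType p c k
    → (rs : Vec (Refl (suc (suc p))) (suc (suc p))) → MinFact (suc (suc p)) c rs
    → Σ (Vec (Refl (suc (suc p))) (suc (suc p))) (λ rs′ →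
        (MinFact (suc (suc p)) c rs′ × ¬ (rs′ ≡ rs) × diagram rs′ ≡ diagram rs)
        × ((ss : Vec (Refl (suc (suc p))) (suc (suc p))) → MinFact (suc (suc p)) c ss
           → diagram ss ≡ diagram rs → (ss ≡ rs) ⊎ (ss ≡ rs′)))
lemma4p1 p c c∈Dn k cycleType rs mf =
  partner c∈Dn cycleType {rs} mf ,
  (partner-MinFact c∈Dn cycleType {rs} mf , partner≢rs c∈Dn cycleType {rs} mf , diagram-toggleAt _ rs) ,
  same-diagram⇒rs⊎partner c∈Dn cycleType {rs} mf
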